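{- Let $f:\{0,1\}^n\to\{0,1\}$ be a Boolean function and let $\ell,k\in\{0,1\}$. Let $g$ be a goal function for $f$. If there is a minimal certificate of $f$ setting $x_i=\ell$, then $g(x_i=\ell)-g(*,\ldots,*)\ge 1$. Similarly, if $g'$ is a $k$-goal function for $f$ and there is a minimal $k$-certificate of $f$ setting $x_i=\ell$, then $g'(x_i=\ell)-g'(*,\ldots,*)\ge 1$; further, if that certificate has size $s$, then the $k$-goal value of $g'$ is at least $s$.
   Context: A partial assignment is $b\in\{0,1,*\}^n$; $a\succeq b$ means $a_i=b_i$ whenever $b_i\ne *$. For $f$, $b$ is a $0$-certificate (resp. $1$-certificate) if $f(a)=0$ (resp. $1$) for all $a\in\{0,1\}^n$ with $a\succeq b$; a certificate is a $0$- or $1$-certificate. A certificate $b$ is minimal if there is no certificate $b'\ne b$ with $b\succeq b'$. The size of $b$ is the number of $i$ with $b_i\ne *$; $b$ sets $x_i=\ell$ if $b_i=\ell$. $b$ contains a certificate if $b\succeq c$ for some certificate $c$. For $b_i=*$, $b_{x_i\leftarrow\ell}$ is $b$ with coordinate $i$ set to $\ell$. $g:\{0,1,*\}^n\to\mathbb{Z}_{\ge0}$ is monotone if $g(b_{x_i\leftarrow\ell})\ge g(b)$ whenever $b_i=*$, and submodular if $g(b_{x_i\leftarrow\ell})-g(b)\ge g(b'_{x_i\leftarrow\ell})-g(b')$ whenever $b'\succeq b$, $b_i=b'_i=*$. A goal function for $f$ is a monotone submodular $g$ such that for some integer $Q\ge0$, $g(b)=Q$ for all $b\in\{0,1\}^n$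 and $g(b)=Q$ iff $b$ contains a certificate of $f$. A $1$-goal function for $f$ is a monotone submodular $g$ such that for some constant $Q\ge0$ (its $1$-goal value), $g(b)=Q$ if $b$ is a $1$-certificate of $f$ and $g(b)<Q$ otherwise; $0$-goal functions and $0$-goal value are defined analogously with $0$-certificates. The notation $g(x_i=\ell)$ denotes $g(b)$ for the $b$ with $b_i=\ell$ and $b_j=*$ for $j\ne i$. -}

module Defs where

open import Data.Bool using (Bool; true; false)
open import Data.Maybe using (Maybe; just; nothing)
open import Data.Nat using (ℕ; zero; suc; _≤_; _<_; _+_)
open import Data.Fin using (Fin)
open import Data.Vec using (Vec; []; _∷_; lookup; replicate; map; _[_]≔_)
open import Data.Product using (Σ; _×_; _,_)
open import Function.Bundles using (_⇔_)
open import Relation.Binary.PropositionalEquality using (_≡_)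
open import Relation.Nullary using (¬_)

-- A partial assignment b ∈ {0,1,*}^n : `just ℓ` = fixed to ℓ, `nothing` = *.
-- Bits are Bool (false = 0, true = 1).
Partial : ℕ → Set
Partial n = Vec (Maybe Bool) n

Total : ℕ → Set
Total n = Vec Bool n

_⪰_ : ∀ {n} → Partial n → Partial n → Set
_⪰_ {n} b c = ∀ (i : Fin n) (x : Bool) → lookup c i ≡ just x → lookup b i ≡ just x

total : ∀ {n} → Total n → Partial n
total a = map just a

IsKCert : ∀ {n} → Bool → (Total n → Bool) → Partial n → Set
IsKCert k f b = ∀ a → total a ⪰ b → f a ≡ k

IsCert : ∀ {n} → (Total n → Bool) → Partial n → Set
IsCert f b = Σ Bool (λ k → IsKCert k f b)

IsMinCert : ∀ {n} → (Total n → Bool) → Partial n → Set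
IsMinCert f b = IsCert f b × (∀ b' → IsCert f b' → b ⪰ b' → b' ≡ b)

IsMinKCert : ∀ {n} → Bool → (Total n → Bool) → Partial n → Set
IsMinKCert k f b = IsKCert k f b × (∀ b' → IsKCert k f b' → b ⪰ b' → b' ≡ b)

ContainsCert : ∀ {n} → (Total n → Bool) → Partial n → Set
ContainsCert f b = Σ _ (λ c → IsCert f c × b ⪰ c)

size : ∀ {n} → Partial n → ℕ
size [] = zero
size (just _ ∷ b) = suc (size b)
size (nothing ∷ b) = size b

stars : ∀ n → Partial n
stars n = replicate n nothing

single : ∀ {n} → Fin n → Bool → Partial n
single {n} i ℓ = stars n [ i ]≔ just ℓ

Monotone : ∀ {n} → (Partial n → ℕ) → Set
Monotone {n} g = ∀ (b : Partial n) (i : Fin n) (ℓ : Bool) →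
  lookup b i ≡ nothing → g b ≤ g (b [ i ]≔ just ℓ)

-- g(b_{i←ℓ}) - g(b) ≥ g(b'_{i←ℓ}) - g(b'), written additively over ℕ
Submodular : ∀ {n} → (Partial n → ℕ) → Set
Submodular {n} g = ∀ (b b' : Partial n) (i : Fin n) (ℓ : Bool) →
  b' ⪰ b → lookup b i ≡ nothing → lookup b' i ≡ nothing →
  g (b' [ i ]≔ just ℓ) + g b ≤ g (b [ i ]≔ just ℓ) + g b'

IsGoal : ∀ {n} → (Total n → Bool) → (Partial n → ℕ) → Set
IsGoal f g = Monotone g × Submodular g ×
  Σ ℕ (λ Q → (∀ a → g (total a) ≡ Q) × (∀ b → (g b ≡ Q) ⇔ ContainsCert f b))

IsKGoal : ∀ {n} → Bool → (Total n → Bool) → (Partial n → ℕ) → ℕ → Set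
IsKGoal k f g Q = Monotone g × Submodular g ×
  (∀ b → IsKCert k f b → g b ≡ Q) × (∀ b → ¬ IsKCert k f b → g b < Q)

-- Submodularity transports a strict marginal gain downwards: if erasing the
-- coordinate j of b strictly lowers g, then setting j on any c ⪯ b with c_j = *
-- strictly raises g, in particular on the all-* assignment.  For a minimal
-- certificate b, erasing a fixed coordinate leaves no certificate inside, so the
-- goal value drops strictly; this gives the first two claims.  When every fixed
-- coordinate of b is essential in this sense, re-setting the coordinates of b one
-- by one starting from * gains at least 1 each time, so g b ≥ size b.
module Submission where

open import Defs
open import Data.Bool using (Bool)
open import Data.Maybe using (just; nothing)
open import Data.Nat using (ℕ; zero; suc; _≤_; _<_; _+_; _∸_; z≤n)
open import Data.Nat.Properties
  using (+-cancelˡ-<; +-monoʳ-<; +-comm; ≤-<-trans; m<n⇒0<n∸m; m≤n⇒m<n∨m≡n; suc-injective)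
open import Data.Fin using (Fin) renaming (zero to fzero; suc to fsuc)
open import Data.Fin.Properties using (_≟_)
open import Data.Vec using (Vec; []; _∷_; lookup; _[_]≔_)
open import Data.Vec.Properties
  using (lookup∘update; lookup∘update′; []≔-idempotent; []≔-lookup; lookup-replicate)
open import Data.Product using (Σ; _×_; _,_; proj₁)
open import Data.Sum using (inj₁; inj₂)
open import Function.Bundles using (Equivalence)
open import Relation.Nullary using (yes; no; ¬_; contradiction)
open import Relation.Binary.PropositionalEquality

⪰-refl : ∀ {n} (b : Partial n) → b ⪰ b
⪰-refl b i x bi = bi

⪰-trans : ∀ {n} (a b c : Partial n) → a ⪰ b → b ⪰ c → a ⪰ c
⪰-trans a b c a⪰b b⪰c i x ci = a⪰b i x (b⪰c i x ci)

⪰-stars : ∀ {n} (b : Partial n) → b ⪰ stars n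
⪰-stars {n} b i x si = contradiction (trans (sym (lookup-replicate i nothing)) si) λ ()

erase : ∀ {n} → Partial n → Fin n → Partial n
erase b j = b [ j ]≔ nothing

lookup-erase : ∀ {n} (b : Partial n) j → lookup (erase b j) j ≡ nothing
lookup-erase b j = lookup∘update j b nothing

⪰-erase : ∀ {n} (b : Partial n) j → b ⪰ erase b j
⪰-erase b j i x ei with i ≟ j
... | yes refl = contradiction (trans (sym (lookup-erase b i)) ei) λ ()
... | no i≢j = trans (sym (lookup∘update′ i≢j b nothing)) ei

erase-⪰ : ∀ {n} (b c : Partial n) j → b ⪰ c → lookup c j ≡ nothing → erase b j ⪰ c
erase-⪰ b c j b⪰c cj i x ci with i ≟ j
... | yes refl = contradiction (trans (sym cj) ci) λ ()
... | no i≢j = trans (lookup∘update′ i≢j b nothing) (b⪰c i x ci)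

erase-restore : ∀ {n} (b : Partial n) j {x} → lookup b j ≡ just x → erase b j [ j ]≔ just x ≡ b
erase-restore b j {x} bj = begin
  erase b j [ j ]≔ just x   ≡⟨ []≔-idempotent b j ⟩
  b [ j ]≔ just x           ≡⟨ cong (b [ j ]≔_) (sym bj) ⟩
  b [ j ]≔ lookup b j       ≡⟨ []≔-lookup b j ⟩
  b                         ∎
  where open ≡-Reasoning

erase-≢ : ∀ {n} (b : Partial n) j {x} → lookup b j ≡ just x → erase b j ≢ b
erase-≢ b j bj e = contradiction (trans (sym (lookup-erase b j)) (trans (cong (λ v → lookup v j) e) bj)) λ ()

erase-⋡ : ∀ {n} (b c : Partial n) j {x} → lookup c j ≡ just x → ¬ (erase b j ⪰ c)
erase-⋡ b c j cj b⁻⪰c = contradiction (trans (sym (lookup-erase b j)) (b⁻⪰c j _ cj)) λ ()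

size-erase : ∀ {n} (b : Partial n) j {x} → lookup b j ≡ just x → suc (size (erase b j)) ≡ size b
size-erase (just _ ∷ b)  fzero    bj = refl
size-erase (just _ ∷ b)  (fsuc j) bj = cong suc (size-erase b j bj)
size-erase (nothing ∷ b) (fsuc j) bj = size-erase b j bj

size-suc⇒fixed : ∀ {n} (b : Partial n) {m} → size b ≡ suc m → Σ (Fin n) λ j → Σ Bool λ x → lookup b j ≡ just x
size-suc⇒fixed (just x ∷ b)  e = fzero , x , refl
size-suc⇒fixed (nothing ∷ b) e with size-suc⇒fixed b e
... | j , x , bj = fsuc j , x , bj

Essential : ∀ {n} → (Partial n → ℕ) → Partial n → Fin n → Set
Essential g b j = g (erase b j) < g b

AllEssential : ∀ {n} → (Partial n → ℕ) → Partial n → Set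
AllEssential g b = ∀ j x → lookup b j ≡ just x → Essential g b j

module _ {n} (g : Partial n → ℕ) (submodular : Submodular g) where

  essential-gain : ∀ (b : Partial n) {c j x} → lookup b j ≡ just x → Essential g b j →
    b ⪰ c → lookup c j ≡ nothing → g c < g (c [ j ]≔ just x)
  essential-gain b {c} {j} {x} bj ess b⪰c cj =
    +-cancelˡ-< (g b) (g c) (g c⁺) (begin-strict
      g b + g c          ≤⟨ subst (λ v → g v + g c ≤ g c⁺ + g (erase b j)) (erase-restore b j bj)
                             (submodular c (erase b j) j x (erase-⪰ b c j b⪰c cj) cj (lookup-erase b j)) ⟩
      g c⁺ + g (erase b j) <⟨ +-monoʳ-< (g c⁺) ess ⟩
      g c⁺ + g b         ≡⟨ +-comm (g c⁺) (g b) ⟩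
      g b + g c⁺         ∎)
    where
    open Data.Nat.Properties.≤-Reasoning
    c⁺ : Partial n
    c⁺ = c [ j ]≔ just x

  essential⇒single-gain : ∀ (b : Partial n) j {x} → lookup b j ≡ just x → Essential g b j →
    1 ≤ g (single j x) ∸ g (stars n)
  essential⇒single-gain b j bj ess =
    m<n⇒0<n∸m (essential-gain b bj ess (⪰-stars b) (lookup-replicate j nothing))

  allEssential⇒size≤ : ∀ (b : Partial n) → AllEssential g b →
    ∀ m (c : Partial n) → size c ≡ m → b ⪰ c → m ≤ g c
  allEssential⇒size≤ b ess zero    c e b⪰c = z≤n
  allEssential⇒size≤ b ess (suc m) c e b⪰c with size-suc⇒fixed c e
  ... | j , x , cj = subst (λ v → suc m ≤ g v) (erase-restore c j cj)
        (≤-<-trans (allEssential⇒size≤ b ess m c⁻ (suc-injective (trans (size-erase c j cj) e)) b⪰c⁻)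
                   (essential-gain b bj (ess j x bj) b⪰c⁻ (lookup-erase c j)))
    where
    c⁻ : Partial n
    c⁻ = erase c j
    b⪰c⁻ : b ⪰ c⁻
    b⪰c⁻ = ⪰-trans b c c⁻ b⪰c (⪰-erase c j)
    bj : lookup b j ≡ just x
    bj = b⪰c j x cj

minCert-essential : ∀ {n} {f : Total n → Bool} {g : Partial n → ℕ} → IsGoal f g →
  ∀ {b} → IsMinCert f b → AllEssential g b
minCert-essential {g = g} (monotone , _ , _ , _ , goal⇔cert) {b} (cert , minimal) j x bj
  with m≤n⇒m<n∨m≡n (subst (λ v → g (erase b j) ≤ g v) (erase-restore b j bj)
                       (monotone (erase b j) j x (lookup-erase b j)))
... | inj₁ lt = lt
... | inj₂ eq with Equivalence.to (goal⇔cert (erase b j))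
                     (trans eq (Equivalence.from (goal⇔cert b) (b , cert , ⪰-refl b)))
...   | c , cert-c , b⁻⪰c =
  contradiction b⁻⪰c (erase-⋡ b c j (subst (λ v → lookup v j ≡ just x) (sym c≡b) bj))
  where
  c≡b : c ≡ b
  c≡b = minimal c cert-c (⪰-trans b (erase b j) c (⪰-erase b j) b⁻⪰c)

minKCert-essential : ∀ {n k} {f : Total n → Bool} {g : Partial n → ℕ} {Q} → IsKGoal k f g Q →
  ∀ {b} → IsMinKCert k f b → AllEssential g b
minKCert-essential {g = g} (_ , _ , cert⇒Q , ¬cert⇒<Q) {b} (cert , minimal) j x bj =
  subst (g (erase b j) <_) (sym (cert⇒Q b cert))
    (¬cert⇒<Q (erase b j) λ cert⁻ → erase-≢ b j bj (minimal (erase b j) cert⁻ (⪰-erase b j)))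

lemma1 : (n : ℕ) (f : Vec Bool n → Bool) (ℓ k : Bool) (i : Fin n) →
    ((g : Partial n → ℕ) → IsGoal f g →
      Σ (Partial n) (λ b → IsMinCert f b × lookup b i ≡ just ℓ) →
      1 ≤ g (single i ℓ) ∸ g (stars n))
    ×
    ((g' : Partial n → ℕ) (Q : ℕ) → IsKGoal k f g' Q →
      (b : Partial n) → IsMinKCert k f b → lookup b i ≡ just ℓ →
      (1 ≤ g' (single i ℓ) ∸ g' (stars n)) × (size b ≤ Q))
lemma1 n f ℓ k i = goal-case , kGoal-case
  where
  goal-case : (g : Partial n → ℕ) → IsGoal f g →
    Σ (Partial n) (λ b → IsMinCert f b × lookup b i ≡ just ℓ) →
    1 ≤ g (single i ℓ) ∸ g (stars n)
  goal-case g isGoal@(_ , submodular , _) (b , minCert , bi) =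
    essential⇒single-gain g submodular b i bi (minCert-essential isGoal minCert i ℓ bi)

  kGoal-case : (g' : Partial n → ℕ) (Q : ℕ) → IsKGoal k f g' Q →
    (b : Partial n) → IsMinKCert k f b → lookup b i ≡ just ℓ →
    (1 ≤ g' (single i ℓ) ∸ g' (stars n)) × (size b ≤ Q)
  kGoal-case g' Q isKGoal@(_ , submodular , cert⇒Q , _) b minKCert bi =
      essential⇒single-gain g' submodular b i bi (ess i ℓ bi)
    , subst (size b ≤_) (cert⇒Q b (proj₁ minKCert))
        (allEssential⇒size≤ g' submodular b ess (size b) b refl (⪰-refl b))
    where
    ess : AllEssential g' b
    ess = minKCert-essential isKGoal minKCert
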